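{- Let $G$ be a finite group with identity $e$, $L$ its Cayley table $L(x,y)=xy$, and for $1\le i\le t$ let $K_i(x,y)=x\mu_i(y)$, where $\mu_i\colon G\to G$ are bijections with $\mu_i(e)=e$, such that $(L,K_1,\dots,K_t)$ is a set of mutually orthogonal Latin squares. Let $(\alpha,\beta,\gamma,\delta_1,\dots,\delta_t)$ be an autotopy of $(L,K_1,\dots,K_t)$, i.e. bijections of $G$ with $\gamma(xy)=\alpha(x)\beta(y)$ and $\delta_i(x\mu_i(y))=\alpha(x)\mu_i(\beta(y))$ for all $x,y\in G$ and all $i$. Then there exist $a,b\in G$ and $\varphi\in\mathrm{Aut}(G)$ such that for all $1\le i\le t$, $\varphi(\mu_i(y))\mu_i(b^{ -1})=\mu_i(\varphi(y)b^{ -1})$ for all $y\in G$, and $\alpha=a\varphi$, $\beta=\varphi b^{ -1}$, $\gamma=a\varphi b^{ -1}$, $\delta_i=a\varphi\,\mu_i(b^{ -1})$, i.e. $\alpha(z)=a\varphi(z)$, $\beta(z)=\varphi(z)b^{ -1}$, $\gamma(z)=a\varphi(z)b^{ -1}$, $\delta_i(z)=a\varphi(z)\mu_i(b^{ -1})$ for all $z\in G$.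
   Context: A set of Latin squares on $G$ is mutually orthogonal if each pair is orthogonal (every ordered pair of symbols occurs exactly once in superposition). An autotopy of the set is a tuple of bijections of $G$ (rows, columns, and the symbols of each square) preserving the orthogonal array $\{(x,y,xy,x\mu_1(y),\dots,x\mu_t(y)):x,y\in G\}$, which amounts to the displayed identities. Such a set is called based on the group $G$. -}

module Defs where

open import Data.Nat using (ℕ; suc)
open import Data.Fin using (Fin; zero; suc)
open import Data.Product using (_×_; _,_)
open import Relation.Binary.PropositionalEquality using (_≡_; _≢_)
open import Function.Definitions using (Bijective)
open import Algebra.Structures using (IsGroup)

-- A finite group: the carrier is (w.l.o.g.) Fin order, with propositional equality.
record FiniteGroup : Set where
  infixl 7 _∙_
  infix 8 _⁻¹
  field
    order   : ℕ
    _∙_     : Fin order → Fin order → Fin order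
    e       : Fin order
    _⁻¹     : Fin order → Fin order
    isGroup : IsGroup _≡_ _∙_ e _⁻¹
  Carrier : Set
  Carrier = Fin order

module _ (G : FiniteGroup) where
  open FiniteGroup G

  IsBijection : (Carrier → Carrier) → Set
  IsBijection f = Bijective _≡_ _≡_ f

  Square : Set
  Square = Carrier → Carrier → Carrier

  IsLatin : Square → Set
  IsLatin A = (∀ x → IsBijection (λ y → A x y)) × (∀ y → IsBijection (λ x → A x y))

  Orthogonal : Square → Square → Set
  Orthogonal A B =
    Bijective {A = Carrier × Carrier} {B = Carrier × Carrier} _≡_ _≡_
      (λ { (x , y) → (A x y , B x y) })

  MutuallyOrthogonal : ∀ {m} → (Fin m → Square) → Set
  MutuallyOrthogonal sq =
    (∀ i → IsLatin (sq i)) × (∀ i j → i ≢ j → Orthogonal (sq i) (sq j))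

  IsAutomorphism : (Carrier → Carrier) → Set
  IsAutomorphism φ = IsBijection φ × (∀ x y → φ (x ∙ y) ≡ φ x ∙ φ y)

  -- The set (L, K₁, …, K_t): index zero is L, index (suc i) is K_i.
  cayleySquares : ∀ {t} → (Fin t → Carrier → Carrier) → Fin (suc t) → Square
  cayleySquares μ zero    x y = x ∙ y
  cayleySquares μ (suc i) x y = x ∙ μ i y

{-# OPTIONS --safe #-}
-- Setting y = e and x = e in γ(xy) = α(x)β(y) gives γ = α·β(e) = α(e)·β, so with a = α(e),
-- b = β(e)⁻¹ and φ = a⁻¹α we get β = φ·b⁻¹; substituting back, α(xy) = α(x)φ(y), i.e. φ is
-- a homomorphism, and it is bijective because α is. In the same way y = e in the identity for
-- δᵢ (with μᵢ(e) = e) gives δᵢ = α·μᵢ(b⁻¹), and then x = e yields the compatibility of φ with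
-- μᵢ.
module Submission where

open import Defs
open import Data.Nat using (ℕ)
open import Data.Fin using (Fin)
open import Data.Product using (_×_; Σ-syntax; _,_)
open import Relation.Binary.PropositionalEquality
  using (_≡_; refl; sym; trans; cong; module ≡-Reasoning)
open import Algebra.Bundles using (Group)
open import Algebra.Structures using (IsGroup)
open import Function.Consequences using (inverseᵇ⇒bijective)
open import Function.Consequences.Propositional
  using (strictlyInverseˡ⇒inverseˡ; strictlyInverseʳ⇒inverseʳ)
import Function.Construct.Composition as Composition
import Algebra.Properties.Group as GroupProperties

module _ (G : FiniteGroup) where
  open FiniteGroup G
  open IsGroup isGroup using (_\\_; assoc; identityˡ; identityʳ)
  open ≡-Reasoning

  group : Group _ _
  group = record { isGroup = isGroup }

  open GroupProperties group
    using (∙-cancelˡ; ∙-cancelʳ; \\-leftDividesˡ; \\-leftDividesʳ; ⁻¹-involutive)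

  \\-bijective : ∀ a → IsBijection G (a \\_)
  \\-bijective a = inverseᵇ⇒bijective _≡_ refl sym trans
    ( strictlyInverseˡ⇒inverseˡ (a \\_) (\\-leftDividesʳ a)
    , strictlyInverseʳ⇒inverseʳ (a \\_) (\\-leftDividesˡ a))

  module CayleyAutotopy {α β γ : Carrier → Carrier}
                        (autotopy : ∀ x y → γ (x ∙ y) ≡ α x ∙ β y) where

    a b : Carrier
    a = α e
    b = β e ⁻¹

    φ : Carrier → Carrier
    φ z = a ⁻¹ ∙ α z

    β-e≡b⁻¹ : β e ≡ b ⁻¹
    β-e≡b⁻¹ = sym (⁻¹-involutive (β e))

    α≡a∙φ : ∀ z → α z ≡ a ∙ φ z
    α≡a∙φ z = sym (\\-leftDividesˡ a (α z))

    γ≡a∙β : ∀ z → γ z ≡ a ∙ β z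
    γ≡a∙β z = trans (cong γ (sym (identityˡ z))) (autotopy e z)

    γ≡α∙b⁻¹ : ∀ z → γ z ≡ α z ∙ b ⁻¹
    γ≡α∙b⁻¹ z = begin
      γ z           ≡⟨ cong γ (identityʳ z) ⟨
      γ (z ∙ e)     ≡⟨ autotopy z e ⟩
      α z ∙ β e     ≡⟨ cong (α z ∙_) β-e≡b⁻¹ ⟩
      α z ∙ b ⁻¹    ∎

    γ≡a∙φ∙b⁻¹ : ∀ z → γ z ≡ a ∙ φ z ∙ b ⁻¹
    γ≡a∙φ∙b⁻¹ z = trans (γ≡α∙b⁻¹ z) (cong (_∙ b ⁻¹) (α≡a∙φ z))

    β≡φ∙b⁻¹ : ∀ z → β z ≡ φ z ∙ b ⁻¹
    β≡φ∙b⁻¹ z = ∙-cancelˡ a _ _ (begin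
      a ∙ β z              ≡⟨ γ≡a∙β z ⟨
      γ z                  ≡⟨ γ≡a∙φ∙b⁻¹ z ⟩
      a ∙ φ z ∙ b ⁻¹       ≡⟨ assoc a (φ z) (b ⁻¹) ⟩
      a ∙ (φ z ∙ b ⁻¹)     ∎)

    α-∙ : ∀ x y → α (x ∙ y) ≡ α x ∙ φ y
    α-∙ x y = ∙-cancelʳ (b ⁻¹) _ _ (begin
      α (x ∙ y) ∙ b ⁻¹     ≡⟨ γ≡α∙b⁻¹ (x ∙ y) ⟨
      γ (x ∙ y)            ≡⟨ autotopy x y ⟩
      α x ∙ β y            ≡⟨ cong (α x ∙_) (β≡φ∙b⁻¹ y) ⟩
      α x ∙ (φ y ∙ b ⁻¹)   ≡⟨ assoc (α x) (φ y) (b ⁻¹) ⟨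
      α x ∙ φ y ∙ b ⁻¹     ∎)

    φ-homo : ∀ x y → φ (x ∙ y) ≡ φ x ∙ φ y
    φ-homo x y = trans (cong (a ⁻¹ ∙_) (α-∙ x y)) (sym (assoc (a ⁻¹) (α x) (φ y)))

    φ-bijective : IsBijection G α → IsBijection G φ
    φ-bijective α-bijective =
      Composition.bijective _≡_ _≡_ _≡_ α-bijective (\\-bijective a)

    φ-automorphism : IsBijection G α → IsAutomorphism G φ
    φ-automorphism α-bijective = φ-bijective α-bijective , φ-homo

    module Mate {μ δ : Carrier → Carrier} (μ-e : μ e ≡ e)
                (mate : ∀ x y → δ (x ∙ μ y) ≡ α x ∙ μ (β y)) where

      δ≡α∙μb⁻¹ : ∀ z → δ z ≡ α z ∙ μ (b ⁻¹)
      δ≡α∙μb⁻¹ z = begin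
        δ z              ≡⟨ cong δ (trans (cong (z ∙_) μ-e) (identityʳ z)) ⟨
        δ (z ∙ μ e)      ≡⟨ mate z e ⟩
        α z ∙ μ (β e)    ≡⟨ cong (λ w → α z ∙ μ w) β-e≡b⁻¹ ⟩
        α z ∙ μ (b ⁻¹)   ∎

      δ≡a∙φ∙μb⁻¹ : ∀ z → δ z ≡ a ∙ φ z ∙ μ (b ⁻¹)
      δ≡a∙φ∙μb⁻¹ z = trans (δ≡α∙μb⁻¹ z) (cong (_∙ μ (b ⁻¹)) (α≡a∙φ z))

      φ-μ-compatible : ∀ y → φ (μ y) ∙ μ (b ⁻¹) ≡ μ (φ y ∙ b ⁻¹)
      φ-μ-compatible y = ∙-cancelˡ a _ _ (begin
        a ∙ (φ (μ y) ∙ μ (b ⁻¹))   ≡⟨ assoc a (φ (μ y)) (μ (b ⁻¹)) ⟨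
        a ∙ φ (μ y) ∙ μ (b ⁻¹)     ≡⟨ δ≡a∙φ∙μb⁻¹ (μ y) ⟨
        δ (μ y)                    ≡⟨ cong δ (identityˡ (μ y)) ⟨
        δ (e ∙ μ y)                ≡⟨ mate e y ⟩
        a ∙ μ (β y)                ≡⟨ cong (λ w → a ∙ μ w) (β≡φ∙b⁻¹ y) ⟩
        a ∙ μ (φ y ∙ b ⁻¹)         ∎)

corollary5p5 :
    (G : FiniteGroup) → let open FiniteGroup G in
    (t : ℕ) (μ : Fin t → Carrier → Carrier) →
    (∀ i → IsBijection G (μ i)) → (∀ i → μ i e ≡ e) →
    MutuallyOrthogonal G (cayleySquares G μ) →
    (α β γ : Carrier → Carrier) (δ : Fin t → Carrier → Carrier) →
    IsBijection G α → IsBijection G β → IsBijection G γ → (∀ i → IsBijection G (δ i)) →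
    (∀ x y → γ (x ∙ y) ≡ α x ∙ β y) →
    (∀ i x y → δ i (x ∙ μ i y) ≡ α x ∙ μ i (β y)) →
    Σ[ a ∈ Carrier ] Σ[ b ∈ Carrier ] Σ[ φ ∈ (Carrier → Carrier) ]
      (IsAutomorphism G φ
      × (∀ i y → φ (μ i y) ∙ μ i (b ⁻¹) ≡ μ i (φ y ∙ b ⁻¹))
      × (∀ z → α z ≡ a ∙ φ z)
      × (∀ z → β z ≡ φ z ∙ b ⁻¹)
      × (∀ z → γ z ≡ (a ∙ φ z) ∙ b ⁻¹)
      × (∀ i z → δ i z ≡ (a ∙ φ z) ∙ μ i (b ⁻¹)))
corollary5p5 G t μ _ μ-e _ α β γ δ α-bijective _ _ _ autotopy mate =
  a , b , φ , φ-automorphism α-bijective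
  , (λ i → Mate.φ-μ-compatible {μ i} {δ i} (μ-e i) (mate i))
  , α≡a∙φ , β≡φ∙b⁻¹ , γ≡a∙φ∙b⁻¹
  , (λ i → Mate.δ≡a∙φ∙μb⁻¹ {μ i} {δ i} (μ-e i) (mate i))
  where open CayleyAutotopy G {α} {β} {γ} autotopy
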